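{- Let $G$ be a graph and $(T,\chi)$ a lenient tree decomposition of $G$. Let $t$ be an internal node of $T$ and suppose there are distinct vertices $x,y\in V(G)$ such that ${\sf Trace}(x)$ is contained in one connected component of $T-t$ and ${\sf Trace}(y)$ is contained in a different connected component of $T-t$. Then $\chi(t)$ is an $(x,y)$-separator of $G$.
   Context: Lenient tree decomposition: $(T,\chi)$, $T$ a tree, $\chi:V(T)\to 2^{V(G)}$, with (C1) bags covering $V(G)$; (C2) every edge $e$ of $G$ satisfies $e\subseteq\chi(t)\cup\chi(t')$ for some close nodes $t,t'$ (equal or adjacent); (C3) ${\sf Trace}(x)=\{t:x\in\chi(t)\}$ is connected in $T$ for every $x$. An internal node is one of degree different from 1. $S$ is an $(x,y)$-separator if $x,y$ lie in different components of $G-S$. -}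

module Defs where

open import Data.Nat using (ℕ; suc; _≤_)
open import Data.Bool using (Bool; T)
open import Data.Fin using (Fin)
open import Data.Fin.Subset using (Subset; _∈_; _∉_)
open import Data.List using (List; []; _∷_; _++_; length; filter; allFin)
open import Data.List.Relation.Unary.Linked using (Linked)
open import Data.List.Relation.Unary.Unique.Propositional using (Unique)
open import Data.Product using (Σ; ∃; ∃-syntax; _×_)
open import Data.Sum using (_⊎_)
open import Data.Unit using (⊤)
open import Relation.Nullary using (¬_)
open import Relation.Nullary.Decidable using (Dec; yes; no)
open import Relation.Binary.PropositionalEquality using (_≡_; _≢_)

record Graph : Set where
  field
    n      : ℕ
    adj    : Fin n → Fin n → Bool
    sym    : ∀ u v → T (adj u v) → T (adj v u)
    irrefl : ∀ u → ¬ T (adj u u)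

  V : Set
  V = Fin n

  Adj : V → V → Set
  Adj u v = T (adj u v)

open Graph public

-- Walks in G all of whose vertices satisfy P (i.e. walks in the induced
-- subgraph G[P]).
data WalkIn (G : Graph) (P : V G → Set) : V G → V G → Set where
  nil  : ∀ {x} → P x → WalkIn G P x x
  cons : ∀ {x y z} → P x → Adj G x y → WalkIn G P y z → WalkIn G P x z

Connected : Graph → Set
Connected G = ∀ (u v : V G) → WalkIn G (λ _ → ⊤) u v

HasCycle : Graph → Set
HasCycle G = Σ (V G) λ x → Σ (List (V G)) λ xs →
  Unique (x ∷ xs) × 2 ≤ length xs × Linked (Adj G) (x ∷ xs ++ x ∷ [])

IsTree : Graph → Set
IsTree G = Connected G × ¬ HasCycle G

degree : (G : Graph) → V G → ℕ
degree G v = length (filter (λ u → T? (adj G v u)) (allFin (n G)))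
  where
    T? : (b : Bool) → Dec (T b)
    T? Bool.true  = yes _
    T? Bool.false = no (λ ())

Internal : (G : Graph) → V G → Set
Internal G v = degree G v ≢ 1

record LenientTD (G : Graph) (Tr : Graph) (χ : V Tr → Subset (n G)) : Set where
  field
    isTree : IsTree Tr
    C1 : ∀ (x : V G) → ∃[ t ] (x ∈ χ t)
    C2 : ∀ (x y : V G) → Adj G x y →
           ∃[ t ] ∃[ t' ] ((t ≡ t' ⊎ Adj Tr t t') ×
             (x ∈ χ t ⊎ x ∈ χ t') × (y ∈ χ t ⊎ y ∈ χ t'))
    C3 : ∀ (x : V G) (t t' : V Tr) → x ∈ χ t → x ∈ χ t' →
           WalkIn Tr (λ s → x ∈ χ s) t t'

-- u and v lie in the same connected component of T - t
ConnAvoiding : (Tr : Graph) → V Tr → V Tr → V Tr → Set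
ConnAvoiding Tr t u v = WalkIn Tr (λ s → s ≢ t) u v

Separator : (G : Graph) → Subset (n G) → V G → V G → Set
Separator G S x y = x ∉ S × y ∉ S × ¬ WalkIn G (λ v → v ∉ S) x y

-- Call a vertex v of G "anchored at c" if its whole trace lies in the component
-- of T - t containing c. An edge vw of G - χ(t) is covered by two close bags,
-- neither of which is t; so the component containing a bag of v is the one
-- containing a bag of w, and connectivity of the trace of w spreads the anchor
-- to all of it. Hence anchoring at c propagates along any walk in G - χ(t),
-- and a walk from x to y would put a bag of y in both components.
module Submission where

open import Defs
open import Data.Fin.Subset using (Subset; _∈_; _∉_)
open import Data.Product using (∃₂; _×_; _,_)
open import Data.Sum using (_⊎_; inj₁; inj₂)
open import Relation.Nullary using (¬_)
open import Relation.Binary.PropositionalEquality using (_≡_; _≢_; refl) renaming (sym to ≡-sym)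

module _ {G : Graph} {P : V G → Set} where

  walk-head : ∀ {u v} → WalkIn G P u v → P u
  walk-head (nil pu)      = pu
  walk-head (cons pu _ _) = pu

  walk-last : ∀ {u v} → WalkIn G P u v → P v
  walk-last (nil pv)      = pv
  walk-last (cons _ _ ws) = walk-last ws

  walk-++ : ∀ {u v w} → WalkIn G P u v → WalkIn G P v w → WalkIn G P u w
  walk-++ (nil _)        vs = vs
  walk-++ (cons pu e us) vs = cons pu e (walk-++ us vs)

  walk-snoc : ∀ {u v w} → WalkIn G P u v → Adj G v w → P w → WalkIn G P u w
  walk-snoc ws e pw = walk-++ ws (cons (walk-last ws) e (nil pw))

  walk-reverse : ∀ {u v} → WalkIn G P u v → WalkIn G P v u
  walk-reverse (nil pu) = nil pu
  walk-reverse {u} (cons {y = v} pu e ws) =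
    walk-snoc (walk-reverse ws) (Graph.sym G u v e) pu

walk-map : ∀ {G : Graph} {P Q : V G → Set} → (∀ v → P v → Q v) →
           ∀ {u w} → WalkIn G P u w → WalkIn G Q u w
walk-map f (nil pu)       = nil (f _ pu)
walk-map f (cons pu e ws) = cons (f _ pu) e (walk-map f ws)

Close : (Tr : Graph) → V Tr → V Tr → Set
Close Tr a b = a ≡ b ⊎ Adj Tr a b

close-sym : ∀ {Tr a b} → Close Tr a b → Close Tr b a
close-sym      (inj₁ a≡b) = inj₁ (≡-sym a≡b)
close-sym {Tr} (inj₂ ab)  = inj₂ (Graph.sym Tr _ _ ab)

connAvoiding-close : ∀ {Tr t c a b} → Close Tr a b → b ≢ t →
                     ConnAvoiding Tr t c a → ConnAvoiding Tr t c b
connAvoiding-close (inj₁ refl) _   ca = ca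
connAvoiding-close (inj₂ ab)   b≢t ca = walk-snoc ca ab b≢t

module _ {G Tr : Graph} {χ : V Tr → Subset (n G)} (td : LenientTD G Tr χ) where
  open LenientTD td

  ∉-bag⇒≢ : ∀ {v s t} → v ∉ χ t → v ∈ χ s → s ≢ t
  ∉-bag⇒≢ v∉t v∈s refl = v∉t v∈s

  edge-in-close-bags : ∀ {v w} → Adj G v w →
                       ∃₂ λ p q → Close Tr p q × v ∈ χ p × w ∈ χ q
  edge-in-close-bags {v} {w} e with C2 v w e
  ... | a , b , ab , inj₁ v∈a , inj₁ w∈a = a , a , inj₁ refl , v∈a , w∈a
  ... | a , b , ab , inj₁ v∈a , inj₂ w∈b = a , b , ab , v∈a , w∈b
  ... | a , b , ab , inj₂ v∈b , inj₁ w∈a = b , a , close-sym {Tr} ab , v∈b , w∈a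
  ... | a , b , ab , inj₂ v∈b , inj₂ w∈b = b , b , inj₁ refl , v∈b , w∈b

  AnchoredAt : V Tr → V Tr → V G → Set
  AnchoredAt t c v = ∀ s → v ∈ χ s → ConnAvoiding Tr t c s

  anchored⇒∉ : ∀ {t c v} → AnchoredAt t c v → v ∉ χ t
  anchored⇒∉ {t} anchored v∈t = walk-last (anchored t v∈t) refl

  anchoredAt-bag : ∀ {t c v s} → v ∉ χ t → v ∈ χ s →
                   ConnAvoiding Tr t c s → AnchoredAt t c v
  anchoredAt-bag {v = v} {s} v∉t v∈s cs s' v∈s' =
    walk-++ cs (walk-map (λ _ → ∉-bag⇒≢ v∉t) (C3 v s s' v∈s v∈s'))

  anchored-edge : ∀ {t c v w} → w ∉ χ t → Adj G v w →
                  AnchoredAt t c v → AnchoredAt t c w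
  anchored-edge w∉t e anchored with edge-in-close-bags e
  ... | p , q , pq , v∈p , w∈q =
    anchoredAt-bag w∉t w∈q
      (connAvoiding-close pq (∉-bag⇒≢ w∉t w∈q) (anchored p v∈p))

  anchored-walk : ∀ {t c v w} → WalkIn G (λ u → u ∉ χ t) v w →
                  AnchoredAt t c v → AnchoredAt t c w
  anchored-walk (nil _)       anchored = anchored
  anchored-walk (cons _ e ws) anchored =
    anchored-walk ws (anchored-edge (walk-head ws) e anchored)

  anchored-unique : ∀ {t c₁ c₂ v} → AnchoredAt t c₁ v → AnchoredAt t c₂ v →
                    ConnAvoiding Tr t c₁ c₂
  anchored-unique {v = v} anchored₁ anchored₂ with C1 v
  ... | s , v∈s = walk-++ (anchored₁ s v∈s) (walk-reverse (anchored₂ s v∈s))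

mainTheorem12 : (G Tr : Graph) (χ : V Tr → Subset (n G)) → LenientTD G Tr χ →
    (t : V Tr) → Internal Tr t → (x y : V G) → x ≢ y →
    (c₁ c₂ : V Tr) → c₁ ≢ t → c₂ ≢ t → ¬ ConnAvoiding Tr t c₁ c₂ →
    (∀ s → x ∈ χ s → ConnAvoiding Tr t c₁ s) →
    (∀ s → y ∈ χ s → ConnAvoiding Tr t c₂ s) →
    Separator G (χ t) x y
mainTheorem12 G Tr χ td t _ x y _ c₁ c₂ _ _ c₁≁c₂ x-anchored y-anchored =
  anchored⇒∉ td x-anchored , anchored⇒∉ td y-anchored , no-walk
  where
  no-walk : ¬ WalkIn G (λ v → v ∉ χ t) x y
  no-walk xy = c₁≁c₂ (anchored-unique td (anchored-walk td xy x-anchored) y-anchored)
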